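{- For any $x\in G$, the element $(x,x)$ belongs to $G$.
   Context: $T$ is the infinite rooted binary tree of finite words over $\{1,2\}$, $W=\mathrm{Aut}(T)$. For $u,v\in W$, $(u,v)\in W$ acts by $1w\mapsto1u(w)$, $2w\mapsto2v(w)$; $\sigma$ swaps the first letter; $(u,v)\sigma=(u,v)\circ\sigma$. $a_1,a_2,a_3\in W$ are defined by $a_1=(\mathrm{id},a_3)$, $a_2=(\mathrm{id},a_1)\sigma$, $a_3=(a_2,\mathrm{id})\sigma$, and $G$ is the closed subgroup of $W$ topologically generated by $a_1,a_2,a_3$. -}

module Defs where

open import Data.Nat using (ℕ; _≤_)
open import Data.List using (List; []; _∷_; length)
open import Data.Fin using (Fin; zero; suc)
open import Data.Bool using (Bool; true; false)
open import Data.Product using (_×_; _,_; ∃)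
open import Relation.Binary.PropositionalEquality using (_≡_)

data Letter : Set where
  𝟏 𝟐 : Letter

-- Vertices of the rooted binary tree T: finite words over {1,2}
Word : Set
Word = List Letter

Map : Set
Map = Word → Word

pair : Map → Map → Map
pair u v []      = []
pair u v (𝟏 ∷ w) = 𝟏 ∷ u w
pair u v (𝟐 ∷ w) = 𝟐 ∷ v w

-- Generators a₁ = (id , a₃), a₂ = (id , a₁)σ, a₃ = (a₂ , id)σ
-- (with (u,v)σ = (u,v) ∘ σ), written out on words, and their inverses.
a₁ a₂ a₃ a₁⁻¹ a₂⁻¹ a₃⁻¹ : Map
a₁ []      = []
a₁ (𝟏 ∷ w) = 𝟏 ∷ w
a₁ (𝟐 ∷ w) = 𝟐 ∷ a₃ w
a₂ []      = []
a₂ (𝟏 ∷ w) = 𝟐 ∷ a₁ w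
a₂ (𝟐 ∷ w) = 𝟏 ∷ w
a₃ []      = []
a₃ (𝟏 ∷ w) = 𝟐 ∷ w
a₃ (𝟐 ∷ w) = 𝟏 ∷ a₂ w
a₁⁻¹ []      = []
a₁⁻¹ (𝟏 ∷ w) = 𝟏 ∷ w
a₁⁻¹ (𝟐 ∷ w) = 𝟐 ∷ a₃⁻¹ w
a₂⁻¹ []      = []
a₂⁻¹ (𝟏 ∷ w) = 𝟐 ∷ w
a₂⁻¹ (𝟐 ∷ w) = 𝟏 ∷ a₁⁻¹ w
a₃⁻¹ []      = []
a₃⁻¹ (𝟏 ∷ w) = 𝟐 ∷ a₂⁻¹ w
a₃⁻¹ (𝟐 ∷ w) = 𝟏 ∷ w

GenSym : Set
GenSym = Fin 3 × Bool

genMap : GenSym → Map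
genMap (zero , false)             = a₁
genMap (suc zero , false)         = a₂
genMap (suc (suc zero) , false)   = a₃
genMap (zero , true)              = a₁⁻¹
genMap (suc zero , true)          = a₂⁻¹
genMap (suc (suc zero) , true)    = a₃⁻¹

-- Evaluation of a group word s₁ s₂ … sₖ as the composite s₁ ∘ s₂ ∘ … ∘ sₖ
-- (the empty word is the identity). Images of these are exactly the
-- elements of the abstract group ⟨a₁,a₂,a₃⟩ ≤ W.
eval : List GenSym → Map
eval []      w = w
eval (s ∷ g) w = genMap s (eval g w)

-- Membership in G = closure of ⟨a₁,a₂,a₃⟩ in W (congruence / pointwise
-- topology): for every level n some element of ⟨a₁,a₂,a₃⟩ agrees with x
-- on all vertices of length ≤ n.
InG : Map → Set
InG x = (n : ℕ) → ∃ λ (g : List GenSym) →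
          (w : Word) → length w ≤ n → x w ≡ eval g w

-- On the level of generators the diagonal is realised inside ⟨a₁,a₂,a₃⟩:
-- (a₁,a₁) = a₂², (a₂,a₂) = a₃², (a₃,a₃) = a₁a₂a₁a₂⁻¹. Substituting these
-- words letter by letter turns every group word g into one evaluating to
-- (eval g , eval g). If g approximates x up to level n, then (g,g)
-- approximates (x,x) up to level n + 1, so (x,x) lies in the closure G.
module Submission where

open import Defs
open import Data.Nat using (ℕ; suc; _≤_; s≤s)
open import Data.Nat.Properties using (m≤n⇒m≤1+n)
open import Data.List using (List; []; _∷_; length; _++_; concatMap)
open import Data.Fin using (zero; suc)
open import Data.Bool using (true; false)
open import Data.Product using (_,_)
open import Function using (_∘_)
open import Relation.Binary.PropositionalEquality

a₁-inverseʳ : a₁ ∘ a₁⁻¹ ≗ λ w → w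
a₂-inverseʳ : a₂ ∘ a₂⁻¹ ≗ λ w → w
a₃-inverseʳ : a₃ ∘ a₃⁻¹ ≗ λ w → w
a₁-inverseʳ []      = refl
a₁-inverseʳ (𝟏 ∷ w) = refl
a₁-inverseʳ (𝟐 ∷ w) = cong (𝟐 ∷_) (a₃-inverseʳ w)
a₂-inverseʳ []      = refl
a₂-inverseʳ (𝟏 ∷ w) = refl
a₂-inverseʳ (𝟐 ∷ w) = cong (𝟐 ∷_) (a₁-inverseʳ w)
a₃-inverseʳ []      = refl
a₃-inverseʳ (𝟏 ∷ w) = cong (𝟏 ∷_) (a₂-inverseʳ w)
a₃-inverseʳ (𝟐 ∷ w) = refl

pair-∘ : ∀ (f g u v : Map) → pair f g ∘ pair u v ≗ pair (f ∘ u) (g ∘ v)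
pair-∘ f g u v []      = refl
pair-∘ f g u v (𝟏 ∷ w) = refl
pair-∘ f g u v (𝟐 ∷ w) = refl

eval-++ : ∀ g h → eval (g ++ h) ≗ eval g ∘ eval h
eval-++ []      h w = refl
eval-++ (s ∷ g) h w = cong (genMap s) (eval-++ g h w)

diagonalWord : GenSym → List GenSym
diagonalWord (zero , false)          = (suc zero , false) ∷ (suc zero , false) ∷ []
diagonalWord (suc zero , false)      = (suc (suc zero) , false) ∷ (suc (suc zero) , false) ∷ []
diagonalWord (suc (suc zero) , false) =
  (zero , false) ∷ (suc zero , false) ∷ (zero , false) ∷ (suc zero , true) ∷ []
diagonalWord (zero , true)           = (suc zero , true) ∷ (suc zero , true) ∷ []
diagonalWord (suc zero , true)       = (suc (suc zero) , true) ∷ (suc (suc zero) , true) ∷ []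
diagonalWord (suc (suc zero) , true) =
  (suc zero , false) ∷ (zero , true) ∷ (suc zero , true) ∷ (zero , true) ∷ []

eval-diagonalWord : ∀ s → eval (diagonalWord s) ≗ pair (genMap s) (genMap s)
eval-diagonalWord (zero , false)           []      = refl
eval-diagonalWord (zero , false)           (𝟏 ∷ w) = refl
eval-diagonalWord (zero , false)           (𝟐 ∷ w) = refl
eval-diagonalWord (suc zero , false)       []      = refl
eval-diagonalWord (suc zero , false)       (𝟏 ∷ w) = refl
eval-diagonalWord (suc zero , false)       (𝟐 ∷ w) = refl
eval-diagonalWord (suc (suc zero) , false) []      = refl
eval-diagonalWord (suc (suc zero) , false) (𝟏 ∷ w) = refl
eval-diagonalWord (suc (suc zero) , false) (𝟐 ∷ w) = cong (λ z → 𝟐 ∷ a₃ z) (a₁-inverseʳ w)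
eval-diagonalWord (zero , true)            []      = refl
eval-diagonalWord (zero , true)            (𝟏 ∷ w) = refl
eval-diagonalWord (zero , true)            (𝟐 ∷ w) = refl
eval-diagonalWord (suc zero , true)        []      = refl
eval-diagonalWord (suc zero , true)        (𝟏 ∷ w) = refl
eval-diagonalWord (suc zero , true)        (𝟐 ∷ w) = refl
eval-diagonalWord (suc (suc zero) , true)  []      = refl
eval-diagonalWord (suc (suc zero) , true)  (𝟏 ∷ w) = refl
eval-diagonalWord (suc (suc zero) , true)  (𝟐 ∷ w) = cong (𝟐 ∷_) (a₁-inverseʳ (a₃⁻¹ w))

eval-concatMap-diagonalWord : ∀ g → eval (concatMap diagonalWord g) ≗ pair (eval g) (eval g)
eval-concatMap-diagonalWord [] []      = refl
eval-concatMap-diagonalWord [] (𝟏 ∷ w) = refl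
eval-concatMap-diagonalWord [] (𝟐 ∷ w) = refl
eval-concatMap-diagonalWord (s ∷ g) w = begin
  eval (diagonalWord s ++ concatMap diagonalWord g) w
    ≡⟨ eval-++ (diagonalWord s) (concatMap diagonalWord g) w ⟩
  eval (diagonalWord s) (eval (concatMap diagonalWord g) w)
    ≡⟨ eval-diagonalWord s _ ⟩
  pair (genMap s) (genMap s) (eval (concatMap diagonalWord g) w)
    ≡⟨ cong (pair (genMap s) (genMap s)) (eval-concatMap-diagonalWord g w) ⟩
  pair (genMap s) (genMap s) (pair (eval g) (eval g) w)
    ≡⟨ pair-∘ (genMap s) (genMap s) (eval g) (eval g) w ⟩
  pair (eval (s ∷ g)) (eval (s ∷ g)) w
    ∎
  where open ≡-Reasoning

AgreeUpTo : ℕ → Map → Map → Set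
AgreeUpTo n x y = ∀ w → length w ≤ n → x w ≡ y w

pair-agreeUpTo : ∀ {n u u′ v v′} → AgreeUpTo n u u′ → AgreeUpTo n v v′ →
                 AgreeUpTo (suc n) (pair u v) (pair u′ v′)
pair-agreeUpTo u≈u′ v≈v′ []      _           = refl
pair-agreeUpTo u≈u′ v≈v′ (𝟏 ∷ w) (s≤s ∣w∣≤n) = cong (𝟏 ∷_) (u≈u′ w ∣w∣≤n)
pair-agreeUpTo u≈u′ v≈v′ (𝟐 ∷ w) (s≤s ∣w∣≤n) = cong (𝟐 ∷_) (v≈v′ w ∣w∣≤n)

lemma7p8 : (x : Map) → InG x → InG (pair x x)
lemma7p8 x x∈G n with x∈G n
... | g , x≈g = concatMap diagonalWord g , λ w ∣w∣≤n →
  trans (pair-agreeUpTo x≈g x≈g w (m≤n⇒m≤1+n ∣w∣≤n))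
        (sym (eval-concatMap-diagonalWord g w))
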